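{- Let $G_n\sim G(n,1/2)$ be an Erdős–Rényi random graph on $n$ vertices. Then $\mathbb{E}[b^A_g(G_n)+b^I_g(G_n)]=\mathbb{E}[b^A_g(G_n)+b^I_g(\overline{G_n})]=\lfloor n/2\rfloor$.
   Context: $G(n,1/2)$ is the random graph on vertex set $\{1,\dots,n\}$ in which each of the $\binom n2$ possible edges is present independently with probability $1/2$; $\overline{G_n}$ is the complement of $G_n$. The balance game on a finite simple graph $G$ is played by two players, Admirable (A) and Impish (I), who alternately select a not-yet-labeled vertex of $G$ until all vertices are labeled; Admirable labels each vertex she selects by $0$ and Impish labels each vertex he selects by $1$. Each edge receives the sum modulo $2$ of the labels of its endpoints. Let $e_0$ and $e_1$ be the numbers of edges labeled $0$ and $1$ at the end; the discrepancy is $d=e_1-e_0$. Admirable tries to minimize $d$ and Impish tries to maximize $d$. $b^A_g(G)$ is the value of $d$ under optimal play when Admirable moves first, and $b^I_g(G)$ is the value under optimal play when Impish moves first. -}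

module Defs where

open import Data.Bool using (Bool; true; false; not; if_then_else_; _xor_)
open import Data.Nat as ℕ using (ℕ; zero; suc; _<ᵇ_)
open import Data.Integer as ℤ using (ℤ; _⊓_; _⊔_; 1ℤ; -1ℤ; 0ℤ)
open import Data.Fin using (Fin; toℕ)
open import Data.List using (List; []; _∷_; _++_; concatMap; map; foldr; filter; length)
open import Data.List.Base using (allFin)
open import Data.Maybe using (Maybe; just; nothing)
open import Data.Product using (_×_; _,_)
open import Data.Vec using (Vec; lookup; replicate; _[_]≔_)
import Data.Vec as V

pairs : (n : ℕ) → List (Fin n × Fin n)
pairs n = concatMap (λ i → concatMap (λ j → if toℕ i <ᵇ toℕ j then (i , j) ∷ [] else [])
                                      (allFin n))
                    (allFin n)

bitStrings : ℕ → List (List Bool)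
bitStrings zero = [] ∷ []
bitStrings (suc m) = map (true ∷_) (bitStrings m) ++ map (false ∷_) (bitStrings m)

-- A graph on Fin n is encoded as a bit string indexed by `pairs n`
-- (bit true = edge present).  `select` extracts the chosen pairs.
select : {A : Set} → List A → List Bool → List A
select [] _ = []
select (_ ∷ _) [] = []
select (a ∷ as) (true ∷ bs) = a ∷ select as bs
select (a ∷ as) (false ∷ bs) = select as bs

edgesOf : (n : ℕ) → List Bool → List (Fin n × Fin n)
edgesOf n bs = select (pairs n) bs

complementBits : List Bool → List Bool
complementBits = map not

-- Partial labeling: nothing = unlabeled, just false = label 0, just true = label 1.
Labeling : ℕ → Set
Labeling n = Vec (Maybe Bool) n

labelOf : Maybe Bool → Bool
labelOf (just b) = b
labelOf nothing = false

-- discrepancy e₁ - e₀ of a (complete) labeling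
disc : {n : ℕ} → List (Fin n × Fin n) → Labeling n → ℤ
disc [] σ = 0ℤ
disc ((u , v) ∷ es) σ =
  (if labelOf (lookup σ u) xor labelOf (lookup σ v) then 1ℤ else -1ℤ) ℤ.+ disc es σ

isFree : Maybe Bool → Bool
isFree nothing = true
isFree (just _) = false

freeVertices : {n : ℕ} → Labeling n → List (Fin n)
freeVertices {n} σ = concatMap (λ v → if isFree (lookup σ v) then v ∷ [] else []) (allFin n)

optList : (ℤ → ℤ → ℤ) → List ℤ → ℤ → ℤ
optList op [] d = d
optList op (x ∷ xs) d = foldr op x xs

-- Value of the balance game under optimal play.
-- `aTurn = true` : Admirable (labels 0, minimizes) is to move;
-- `aTurn = false`: Impish (labels 1, maximizes) is to move.
-- The fuel k counts remaining moves; starting from the empty labeling with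
-- fuel n, the game ends exactly when all vertices are labeled.
gameValue : {n : ℕ} → ℕ → Bool → List (Fin n × Fin n) → Labeling n → ℤ
gameValue zero aTurn E σ = disc E σ
gameValue (suc k) aTurn E σ =
  optList (if aTurn then _⊓_ else _⊔_)
          (map (λ v → gameValue k (not aTurn) E (σ [ v ]≔ just (not aTurn)))
               (freeVertices σ))
          (disc E σ)

bA : (n : ℕ) → List (Fin n × Fin n) → ℤ
bA n E = gameValue n true E (replicate n nothing)

bI : (n : ℕ) → List (Fin n × Fin n) → ℤ
bI n E = gameValue n false E (replicate n nothing)

sumℤ : List ℤ → ℤ
sumℤ = foldr ℤ._+_ 0ℤ

{-# OPTIONS --safe #-}
module Submission where

-- Flipping every label of a complete labeling preserves the weight of every edge. With signs
-- s_v = ±1 the discrepancy of K_n is (n − (Σ s_v)²)/2, and in every play the first player labels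
-- ⌈n/2⌉ vertices, so at the end of any play disc G + disc (complement G) = ⌊n/2⌋. Flipping all
-- labels therefore turns the Admirable-first game on G into the Impish-first game on the
-- complement with payoff ⌊n/2⌋ − d, so b^A(G) + b^I(complement G) = ⌊n/2⌋ for every G. Summing
-- over all G gives the second identity, and the first follows because complementation
-- permutes the graphs.

open import Defs
open import Data.Nat using (ℕ; _/_; _^_)
open import Data.Integer using (ℤ; +_; _*_; _+_)
open import Data.List using (map; length)
open import Data.Product using (_×_)
open import Relation.Binary.PropositionalEquality using (_≡_)

open import Data.Bool using (Bool; true; false; not; if_then_else_; _xor_)
open import Data.Nat using (zero; suc; s≤s; z≤n; _<ᵇ_)
open import Data.Nat.Properties using (suc-injective)
open import Data.Nat.DivMod using (m/n≡1+[m∸n]/n)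
open import Data.Integer using (-_; _-_; _⊓_; _⊔_; 0ℤ; 1ℤ; -1ℤ)
open import Data.Integer.Properties
  using (+-identityˡ; +-identityʳ; +-assoc; +-comm; *-cancelˡ-≡; +-monoʳ-<; neg-mono-<;
         antimono-<-distrib-⊓; antimono-<-distrib-⊔; +-commutativeSemigroup)
open import Data.Integer.Tactic.RingSolver using (solve-∀)
open import Algebra.Properties.CommutativeSemigroup +-commutativeSemigroup using (x∙yz≈y∙xz)
open import Data.Fin using (Fin; toℕ) renaming (zero to fzero; suc to fsuc)
open import Data.List using (List; []; _∷_; _++_; concatMap; foldr; allFin)
open import Data.List.Properties
  using (length-map; map-++; map-∘; map-tabulate; concatMap-cong; concatMap-map; map-concatMap; concatMap-pure)
open import Data.List.Relation.Unary.All as All using (All; []; _∷_)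
open import Data.List.Relation.Unary.All.Properties using (map⁺)
open import Data.Maybe using (just; nothing)
import Data.Maybe as Maybe
open import Data.Product using (_,_)
open import Data.Vec using ([]; _∷_; lookup; replicate; _[_]≔_)
import Data.Vec as Vec
open import Data.Vec.Properties using (lookup-map; map-[]≔; map-replicate)
open import Relation.Binary.PropositionalEquality
  using (refl; sym; trans; cong; cong₂; subst; module ≡-Reasoning)
open import Function using (_∘_; id)

sumℤ-++ : ∀ (xs ys : List ℤ) → sumℤ (xs ++ ys) ≡ sumℤ xs + sumℤ ys
sumℤ-++ []       ys = sym (+-identityˡ (sumℤ ys))
sumℤ-++ (x ∷ xs) ys = trans (cong (_+_ x) (sumℤ-++ xs ys)) (sym (+-assoc x (sumℤ xs) (sumℤ ys)))

allFin-suc : ∀ n → allFin (suc n) ≡ fzero ∷ map fsuc (allFin n)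
allFin-suc n = cong (fzero ∷_) (sym (map-tabulate id fsuc))

map-allFin-suc : ∀ {B : Set} n (f : Fin (suc n) → B) →
  map f (allFin (suc n)) ≡ f fzero ∷ map (f ∘ fsuc) (allFin n)
map-allFin-suc n f = trans (cong (map f) (allFin-suc n)) (cong (f fzero ∷_) (sym (map-∘ (allFin n))))

concatMap-allFin-suc : ∀ {B : Set} n (f : Fin (suc n) → List B) →
  concatMap f (allFin (suc n)) ≡ f fzero ++ concatMap (f ∘ fsuc) (allFin n)
concatMap-allFin-suc n f =
  trans (cong (concatMap f) (allFin-suc n)) (cong (f fzero ++_) (concatMap-map f fsuc (allFin n)))

sign : Bool → ℤ
sign true  = 1ℤ
sign false = -1ℤ

sign*sign≡1 : ∀ b → sign b * sign b ≡ 1ℤ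
sign*sign≡1 true  = refl
sign*sign≡1 false = refl

xor-weight≡-sign*sign : ∀ a b → (if a xor b then 1ℤ else -1ℤ) ≡ - (sign a * sign b)
xor-weight≡-sign*sign true  true  = refl
xor-weight≡-sign*sign true  false = refl
xor-weight≡-sign*sign false true  = refl
xor-weight≡-sign*sign false false = refl

not-xor-not : ∀ a b → not a xor not b ≡ a xor b
not-xor-not true  true  = refl
not-xor-not true  false = refl
not-xor-not false true  = refl
not-xor-not false false = refl

-- A free vertex counts as labelled 0 (labelOf nothing = false), i.e. with sign -1.
signAt : ∀ {n} → Labeling n → Fin n → ℤ
signAt σ v = sign (labelOf (lookup σ v))

signSum : ∀ {n} → Labeling n → ℤ
signSum []      = 0ℤ
signSum (x ∷ σ) = sign (labelOf x) + signSum σ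

freeCount : ∀ {n} → Labeling n → ℕ
freeCount []            = 0
freeCount (nothing ∷ σ) = suc (freeCount σ)
freeCount (just _ ∷ σ)  = freeCount σ

flipLabeling : ∀ {n} → Labeling n → Labeling n
flipLabeling = Vec.map (Maybe.map not)

moveGain : Bool → ℤ
moveGain b = sign b + 1ℤ

freeAt : ∀ {n} → Labeling n → Fin n → List (Fin n)
freeAt σ v = if isFree (lookup σ v) then v ∷ [] else []

freeVertices-∷ : ∀ {n} x (σ : Labeling n) →
  freeVertices (x ∷ σ) ≡ (if isFree x then fzero ∷ [] else []) ++ map fsuc (freeVertices σ)
freeVertices-∷ {n} x σ =
  trans (concatMap-allFin-suc n (freeAt (x ∷ σ)))
        (cong (_ ++_) (trans (concatMap-cong shift (allFin n))
                             (sym (map-concatMap fsuc (freeAt σ) (allFin n)))))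
  where
  shift : ∀ v → freeAt (x ∷ σ) (fsuc v) ≡ map fsuc (freeAt σ v)
  shift v with isFree (lookup σ v)
  ... | true  = refl
  ... | false = refl

length-freeVertices : ∀ {n} (σ : Labeling n) → length (freeVertices σ) ≡ freeCount σ
length-freeVertices [] = refl
length-freeVertices (nothing ∷ σ) = trans (cong length (freeVertices-∷ nothing σ))
  (cong suc (trans (length-map fsuc (freeVertices σ)) (length-freeVertices σ)))
length-freeVertices (just b ∷ σ) = trans (cong length (freeVertices-∷ (just b) σ))
  (trans (length-map fsuc (freeVertices σ)) (length-freeVertices σ))

freeVertices-free : ∀ {n} (σ : Labeling n) → All (λ v → lookup σ v ≡ nothing) (freeVertices σ)
freeVertices-free [] = []
freeVertices-free (nothing ∷ σ) = subst (All (λ v → lookup (nothing ∷ σ) v ≡ nothing))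
  (sym (freeVertices-∷ nothing σ)) (refl ∷ map⁺ (freeVertices-free σ))
freeVertices-free (just b ∷ σ) = subst (All (λ v → lookup (just b ∷ σ) v ≡ nothing))
  (sym (freeVertices-∷ (just b) σ)) (map⁺ (freeVertices-free σ))

freeVertices-flip : ∀ {n} (σ : Labeling n) → freeVertices (flipLabeling σ) ≡ freeVertices σ
freeVertices-flip {n} σ = concatMap-cong same (allFin n)
  where
  same : ∀ v → freeAt (flipLabeling σ) v ≡ freeAt σ v
  same v rewrite lookup-map v (Maybe.map not) σ with lookup σ v
  ... | nothing = refl
  ... | just _  = refl

freeCount-update : ∀ {n} (σ : Labeling n) v b → lookup σ v ≡ nothing →
  suc (freeCount (σ [ v ]≔ just b)) ≡ freeCount σ
freeCount-update (nothing ∷ σ) fzero    b _    = refl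
freeCount-update (just _ ∷ σ)  fzero    b ()
freeCount-update (nothing ∷ σ) (fsuc v) b free = cong suc (freeCount-update σ v b free)
freeCount-update (just _ ∷ σ)  (fsuc v) b free = freeCount-update σ v b free

signSum-update : ∀ {n} (σ : Labeling n) v b → lookup σ v ≡ nothing →
  signSum (σ [ v ]≔ just b) ≡ signSum σ + moveGain b
signSum-update (nothing ∷ σ) fzero b _ = gain (sign b) (signSum σ)
  where
  gain : ∀ s S → s + S ≡ -1ℤ + S + (s + 1ℤ)
  gain = solve-∀
signSum-update (just _ ∷ σ) fzero b ()
signSum-update (x ∷ σ) (fsuc v) b free =
  trans (cong (_+_ (sign (labelOf x))) (signSum-update σ v b free))
        (sym (+-assoc (sign (labelOf x)) (signSum σ) (moveGain b)))

labelOf-flip : ∀ {n} (τ : Labeling n) → freeCount τ ≡ 0 →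
  ∀ v → labelOf (lookup (flipLabeling τ) v) ≡ not (labelOf (lookup τ v))
labelOf-flip (nothing ∷ τ) () v
labelOf-flip (just b ∷ τ)  _        fzero    = refl
labelOf-flip (just b ∷ τ)  complete (fsuc v) = labelOf-flip τ complete v

freeCount-replicate : ∀ n → freeCount (replicate n nothing) ≡ n
freeCount-replicate zero    = refl
freeCount-replicate (suc n) = cong suc (freeCount-replicate n)

weight : ∀ {n} → Labeling n → Fin n → Fin n → ℤ
weight σ u v = if labelOf (lookup σ u) xor labelOf (lookup σ v) then 1ℤ else -1ℤ

disc-++ : ∀ {n} (E F : List (Fin n × Fin n)) σ → disc (E ++ F) σ ≡ disc E σ + disc F σ
disc-++ [] F σ = sym (+-identityˡ (disc F σ))
disc-++ ((u , v) ∷ E) F σ =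
  trans (cong (_+_ (weight σ u v)) (disc-++ E F σ)) (sym (+-assoc (weight σ u v) (disc E σ) (disc F σ)))

disc-complementary : ∀ {n} (E : List (Fin n × Fin n)) (τ τ′ : Labeling n) →
  (∀ v → labelOf (lookup τ′ v) ≡ not (labelOf (lookup τ v))) → disc E τ′ ≡ disc E τ
disc-complementary [] τ τ′ complementary = refl
disc-complementary ((u , v) ∷ E) τ τ′ complementary
  rewrite complementary u | complementary v | not-xor-not (labelOf (lookup τ u)) (labelOf (lookup τ v)) =
  cong (_+_ (weight τ u v)) (disc-complementary E τ τ′ complementary)

disc-select+disc-select-complement : ∀ {n} (P : List (Fin n × Fin n)) bs σ → length bs ≡ length P →
  disc (select P bs) σ + disc (select P (map not bs)) σ ≡ disc P σ
disc-select+disc-select-complement [] [] σ _ = refl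
disc-select+disc-select-complement ((u , v) ∷ P) (true ∷ bs) σ eq =
  trans (+-assoc (weight σ u v) (disc (select P bs) σ) _)
        (cong (_+_ (weight σ u v)) (disc-select+disc-select-complement P bs σ (suc-injective eq)))
disc-select+disc-select-complement ((u , v) ∷ P) (false ∷ bs) σ eq =
  trans (x∙yz≈y∙xz (disc (select P bs) σ) (weight σ u v) _)
        (cong (_+_ (weight σ u v)) (disc-select+disc-select-complement P bs σ (suc-injective eq)))

edgesFromZero : ∀ {n} → List (Fin n) → List (Fin (suc n) × Fin (suc n))
edgesFromZero = map (λ j → fzero , fsuc j)

shiftPair : ∀ {n} → Fin n × Fin n → Fin (suc n) × Fin (suc n)
shiftPair (u , v) = fsuc u , fsuc v

pairs-suc : ∀ n → pairs (suc n) ≡ edgesFromZero (allFin n) ++ map shiftPair (pairs n)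
pairs-suc n = trans (concatMap-allFin-suc n row) (cong₂ _++_ first-row later-rows)
  where
  cell : ∀ {m} → Fin m → Fin m → List (Fin m × Fin m)
  cell i j = if toℕ i <ᵇ toℕ j then (i , j) ∷ [] else []
  row : ∀ {m} → Fin m → List (Fin m × Fin m)
  row {m} i = concatMap (cell i) (allFin m)
  first-row : row fzero ≡ edgesFromZero (allFin n)
  first-row = trans (concatMap-allFin-suc n (cell fzero))
                    (trans (sym (concatMap-map (_∷ []) (λ j → fzero , fsuc j) (allFin n)))
                           (concatMap-pure (edgesFromZero (allFin n))))
  shift-cell : ∀ i j → cell (fsuc i) (fsuc j) ≡ map shiftPair (cell i j)
  shift-cell i j with toℕ i <ᵇ toℕ j
  ... | true  = refl
  ... | false = refl
  shift-row : ∀ i → row (fsuc i) ≡ map shiftPair (row i)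
  shift-row i = trans (concatMap-allFin-suc n (cell (fsuc i)))
    (trans (concatMap-cong (shift-cell i) (allFin n)) (sym (map-concatMap shiftPair (cell i) (allFin n))))
  later-rows : concatMap (row ∘ fsuc) (allFin n) ≡ map shiftPair (pairs n)
  later-rows = trans (concatMap-cong shift-row (allFin n)) (sym (map-concatMap shiftPair row (allFin n)))

disc-map-shiftPair : ∀ {n} (P : List (Fin n × Fin n)) x (τ : Labeling n) →
  disc (map shiftPair P) (x ∷ τ) ≡ disc P τ
disc-map-shiftPair [] x τ = refl
disc-map-shiftPair ((u , v) ∷ P) x τ = cong (_+_ (weight τ u v)) (disc-map-shiftPair P x τ)

disc-edgesFromZero : ∀ {n} (L : List (Fin n)) x (τ : Labeling n) →
  disc (edgesFromZero L) (x ∷ τ) ≡ - (sign (labelOf x) * sumℤ (map (signAt τ) L))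
disc-edgesFromZero [] x τ = empty (sign (labelOf x))
  where
  empty : ∀ s → 0ℤ ≡ - (s * 0ℤ)
  empty = solve-∀
disc-edgesFromZero (j ∷ L) x τ =
  trans (cong₂ _+_ (xor-weight≡-sign*sign (labelOf x) (labelOf (lookup τ j))) (disc-edgesFromZero L x τ))
        (factor (sign (labelOf x)) (signAt τ j) (sumℤ (map (signAt τ) L)))
  where
  factor : ∀ s t S → - (s * t) + - (s * S) ≡ - (s * (t + S))
  factor = solve-∀

sumℤ-signAt : ∀ {n} (τ : Labeling n) → sumℤ (map (signAt τ) (allFin n)) ≡ signSum τ
sumℤ-signAt [] = refl
sumℤ-signAt {suc n} (x ∷ τ) =
  trans (cong sumℤ (map-allFin-suc n (signAt (x ∷ τ)))) (cong (_+_ (sign (labelOf x))) (sumℤ-signAt τ))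

-- With signs s_v, the edge uv has discrepancy −s_u s_v, and Σ_{u<v} 2 s_u s_v = (Σ s_v)² − n.
disc-pairs : ∀ n (τ : Labeling n) → + 2 * disc (pairs n) τ ≡ + n - signSum τ * signSum τ
disc-pairs zero [] = refl
disc-pairs (suc n) (x ∷ τ) = begin
    + 2 * disc (pairs (suc n)) (x ∷ τ)
  ≡⟨ cong (λ P → + 2 * disc P (x ∷ τ)) (pairs-suc n) ⟩
    + 2 * disc (edgesFromZero (allFin n) ++ map shiftPair (pairs n)) (x ∷ τ)
  ≡⟨ cong (_*_ (+ 2)) (disc-++ (edgesFromZero (allFin n)) (map shiftPair (pairs n)) (x ∷ τ)) ⟩
    + 2 * (disc (edgesFromZero (allFin n)) (x ∷ τ) + disc (map shiftPair (pairs n)) (x ∷ τ))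
  ≡⟨ cong₂ (λ a b → + 2 * (a + b))
           (trans (disc-edgesFromZero (allFin n) x τ) (cong (λ S → - (s * S)) (sumℤ-signAt τ)))
           (disc-map-shiftPair (pairs n) x τ) ⟩
    + 2 * (- (s * signSum τ) + disc (pairs n) τ)
  ≡⟨ add-vertex s (signSum τ) (disc (pairs n) τ) (+ n) (sign*sign≡1 (labelOf x)) (disc-pairs n τ) ⟩
    + suc n - signSum (x ∷ τ) * signSum (x ∷ τ) ∎
  where
  open ≡-Reasoning
  s : ℤ
  s = sign (labelOf x)
  add-vertex : ∀ s S D N → s * s ≡ 1ℤ → + 2 * D ≡ N - S * S →
    + 2 * (- (s * S) + D) ≡ (1ℤ + N) - (s + S) * (s + S)
  add-vertex s S D N s²≡1 IH = begin
      + 2 * (- (s * S) + D)             ≡⟨ expand s S D ⟩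
      - (+ 2 * s * S) + + 2 * D         ≡⟨ cong (_+_ (- (+ 2 * s * S))) IH ⟩
      - (+ 2 * s * S) + (N - S * S)     ≡⟨ complete-square s S N ⟩
      (s * s + N) - (s + S) * (s + S)   ≡⟨ cong (λ t → (t + N) - (s + S) * (s + S)) s²≡1 ⟩
      (1ℤ + N) - (s + S) * (s + S)      ∎
    where
    expand : ∀ s S D → + 2 * (- (s * S) + D) ≡ - (+ 2 * s * S) + + 2 * D
    expand = solve-∀
    complete-square : ∀ s S N → - (+ 2 * s * S) + (N - S * S) ≡ (s * s + N) - (s + S) * (s + S)
    complete-square = solve-∀

opOf : Bool → ℤ → ℤ → ℤ
opOf t = if t then _⊓_ else _⊔_

sub-opOf : ∀ t C a b → C - opOf t a b ≡ opOf (not t) (C - a) (C - b)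
sub-opOf true  C a b = antimono-<-distrib-⊓ (_-_ C) (λ a<b → +-monoʳ-< C (neg-mono-< a<b)) a b
sub-opOf false C a b = antimono-<-distrib-⊔ (_-_ C) (λ a<b → +-monoʳ-< C (neg-mono-< a<b)) a b

foldr-opOf-sub : ∀ {A : Set} t C (f g : A → ℤ) a L → All (λ v → f v ≡ C - g v) (a ∷ L) →
  foldr (opOf (not t)) (f a) (map f L) ≡ C - foldr (opOf t) (g a) (map g L)
foldr-opOf-sub t C f g a []      (fa ∷ _) = fa
foldr-opOf-sub t C f g a (b ∷ L) (fa ∷ fb ∷ fL) =
  trans (cong₂ (opOf (not t)) fb (foldr-opOf-sub t C f g a L (fa ∷ fL)))
        (sym (sub-opOf t C (g b) (foldr (opOf t) (g a) (map g L))))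

optList-opOf-sub : ∀ {A : Set} t C (f g : A → ℤ) (L : List A) d d′ {k} → length L ≡ suc k →
  All (λ v → f v ≡ C - g v) L →
  optList (opOf (not t)) (map f L) d ≡ C - optList (opOf t) (map g L) d′
optList-opOf-sub t C f g (a ∷ L) d d′ _ fL = foldr-opOf-sub t C f g a L fL

-- Each Impish move raises signSum by 2, each Admirable move leaves it unchanged.
signGain : ℕ → Bool → ℤ
signGain zero    t = 0ℤ
signGain (suc k) t = moveGain (not t) + signGain k (not t)

-- Flipping all labels swaps the roles of the players; the invariant says that every play
-- from σ ends with signSum T.
gameValue-flip : ∀ {n} (E E′ : List (Fin n × Fin n)) (C T : ℤ) →
  (∀ τ → freeCount τ ≡ 0 → signSum τ ≡ T → disc E′ (flipLabeling τ) ≡ C - disc E τ) →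
  ∀ k t (σ : Labeling n) → freeCount σ ≡ k → signSum σ + signGain k t ≡ T →
  gameValue k (not t) E′ (flipLabeling σ) ≡ C - gameValue k t E σ
gameValue-flip E E′ C T final zero t σ complete reaches =
  final σ complete (trans (sym (+-identityʳ (signSum σ))) reaches)
gameValue-flip {n} E E′ C T final (suc k) t σ free reaches = begin
    optList (opOf (not t)) (map flippedMove (freeVertices (flipLabeling σ))) (disc E′ (flipLabeling σ))
  ≡⟨ cong (λ vs → optList (opOf (not t)) (map flippedMove vs) (disc E′ (flipLabeling σ)))
          (freeVertices-flip σ) ⟩
    optList (opOf (not t)) (map flippedMove (freeVertices σ)) (disc E′ (flipLabeling σ))
  ≡⟨ optList-opOf-sub t C flippedMove move (freeVertices σ) _ (disc E σ)
       (trans (length-freeVertices σ) free) (All.map move-dual (freeVertices-free σ)) ⟩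
    C - optList (opOf t) (map move (freeVertices σ)) (disc E σ) ∎
  where
  open ≡-Reasoning
  move : Fin n → ℤ
  move v = gameValue k (not t) E (σ [ v ]≔ just (not t))
  flippedMove : Fin n → ℤ
  flippedMove v = gameValue k (not (not t)) E′ (flipLabeling σ [ v ]≔ just (not (not t)))
  move-dual : ∀ {v} → lookup σ v ≡ nothing → flippedMove v ≡ C - move v
  move-dual {v} free-v =
    trans (cong (gameValue k (not (not t)) E′) (sym (map-[]≔ (Maybe.map not) σ v)))
          (gameValue-flip E E′ C T final k (not t) (σ [ v ]≔ just (not t))
             (suc-injective (trans (freeCount-update σ v (not t) free-v) free))
             (trans (cong (_+ signGain k (not t)) (signSum-update σ v (not t) free-v))
                    (trans (+-assoc (signSum σ) (moveGain (not t)) (signGain k (not t))) reaches)))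

finalSignSum : ℕ → ℤ
finalSignSum n = signSum (replicate n nothing) + signGain n true

finalSignSum-suc-suc : ∀ n → finalSignSum (suc (suc n)) ≡ finalSignSum n
finalSignSum-suc-suc n = two-moves (signSum (replicate n nothing)) (signGain n true)
  where
  two-moves : ∀ S G → (-1ℤ + (-1ℤ + S)) + ((-1ℤ + 1ℤ) + ((1ℤ + 1ℤ) + G)) ≡ S + G
  two-moves = solve-∀

n-finalSignSum²≡2*[n/2] : ∀ n → + n - finalSignSum n * finalSignSum n ≡ + 2 * + (n / 2)
n-finalSignSum²≡2*[n/2] zero          = refl
n-finalSignSum²≡2*[n/2] (suc zero)    = refl
n-finalSignSum²≡2*[n/2] (suc (suc n))
  rewrite finalSignSum-suc-suc n | m/n≡1+[m∸n]/n {suc (suc n)} {2} (s≤s (s≤s z≤n)) =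
  add-two (+ n) (finalSignSum n * finalSignSum n) (+ (n / 2)) (n-finalSignSum²≡2*[n/2] n)
  where
  add-two : ∀ N X q → N - X ≡ + 2 * q → (+ 2 + N) - X ≡ + 2 * (1ℤ + q)
  add-two N X q eq = trans (shift N X) (trans (cong (_+_ (+ 2)) eq) (distrib q))
    where
    shift : ∀ N X → (+ 2 + N) - X ≡ + 2 + (N - X)
    shift = solve-∀
    distrib : ∀ q → + 2 + + 2 * q ≡ + 2 * (1ℤ + q)
    distrib = solve-∀

disc-pairs-final : ∀ n (τ : Labeling n) → signSum τ ≡ finalSignSum n → disc (pairs n) τ ≡ + (n / 2)
disc-pairs-final n τ final = *-cancelˡ-≡ (+ 2) _ _
  (trans (disc-pairs n τ) (trans (cong (λ S → + n - S * S) final) (n-finalSignSum²≡2*[n/2] n)))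

bA+bI-complement : ∀ n bs → length bs ≡ length (pairs n) →
  bA n (edgesOf n bs) + bI n (edgesOf n (complementBits bs)) ≡ + (n / 2)
bA+bI-complement n bs len = begin
    bA n E + bI n E′
  ≡⟨ cong (λ σ → bA n E + gameValue n false E′ σ) (sym (map-replicate (Maybe.map not) nothing n)) ⟩
    bA n E + gameValue n false E′ (flipLabeling (replicate n nothing))
  ≡⟨ cong (_+_ (bA n E))
          (gameValue-flip E E′ (+ (n / 2)) (finalSignSum n) final n true (replicate n nothing)
             (freeCount-replicate n) refl) ⟩
    bA n E + (+ (n / 2) - bA n E)
  ≡⟨ x+[c-x]≡c (bA n E) (+ (n / 2)) ⟩
    + (n / 2) ∎
  where
  open ≡-Reasoning
  E E′ : List (Fin n × Fin n)
  E  = edgesOf n bs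
  E′ = edgesOf n (complementBits bs)
  x+[c-x]≡c : ∀ x c → x + (c - x) ≡ c
  x+[c-x]≡c = solve-∀
  x+y≡c⇒y≡c-x : ∀ x y c → x + y ≡ c → y ≡ c - x
  x+y≡c⇒y≡c-x x y c refl = cancel x y
    where
    cancel : ∀ x y → y ≡ (x + y) - x
    cancel = solve-∀
  final : ∀ τ → freeCount τ ≡ 0 → signSum τ ≡ finalSignSum n →
    disc E′ (flipLabeling τ) ≡ + (n / 2) - disc E τ
  final τ complete signs = begin
      disc E′ (flipLabeling τ)
    ≡⟨ x+y≡c⇒y≡c-x _ _ _ (disc-select+disc-select-complement (pairs n) bs (flipLabeling τ) len) ⟩
      disc (pairs n) (flipLabeling τ) - disc E (flipLabeling τ)
    ≡⟨ cong₂ _-_ (disc-complementary (pairs n) τ (flipLabeling τ) (labelOf-flip τ complete))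
                 (disc-complementary E τ (flipLabeling τ) (labelOf-flip τ complete)) ⟩
      disc (pairs n) τ - disc E τ
    ≡⟨ cong (_- disc E τ) (disc-pairs-final n τ signs) ⟩
      + (n / 2) - disc E τ ∎

sumℤ-map-+ : ∀ {A : Set} (f g : A → ℤ) (xs : List A) →
  sumℤ (map (λ x → f x + g x) xs) ≡ sumℤ (map f xs) + sumℤ (map g xs)
sumℤ-map-+ f g [] = refl
sumℤ-map-+ f g (x ∷ xs) =
  trans (cong (_+_ (f x + g x)) (sumℤ-map-+ f g xs))
        (interchange (f x) (g x) (sumℤ (map f xs)) (sumℤ (map g xs)))
  where
  interchange : ∀ a b c d → a + b + (c + d) ≡ (a + c) + (b + d)
  interchange = solve-∀

sumℤ-bitStrings-suc : ∀ m (f : List Bool → ℤ) → sumℤ (map f (bitStrings (suc m))) ≡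
  sumℤ (map (f ∘ (true ∷_)) (bitStrings m)) + sumℤ (map (f ∘ (false ∷_)) (bitStrings m))
sumℤ-bitStrings-suc m f =
  trans (cong sumℤ (map-++ f (map (true ∷_) (bitStrings m)) (map (false ∷_) (bitStrings m))))
        (trans (sumℤ-++ (map f (map (true ∷_) (bitStrings m))) (map f (map (false ∷_) (bitStrings m))))
               (sym (cong₂ _+_ (cong sumℤ (map-∘ (bitStrings m))) (cong sumℤ (map-∘ (bitStrings m))))))

sumℤ-bitStrings-const : ∀ m (f : List Bool → ℤ) c → (∀ bs → length bs ≡ m → f bs ≡ c) →
  sumℤ (map f (bitStrings m)) ≡ c * + (2 ^ m)
sumℤ-bitStrings-const zero f c const = trans (cong (_+ 0ℤ) (const [] refl)) (one c)
  where
  one : ∀ c → c + 0ℤ ≡ c * 1ℤ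
  one = solve-∀
sumℤ-bitStrings-const (suc m) f c const = trans (sumℤ-bitStrings-suc m f)
  (trans (cong₂ _+_ (sumℤ-bitStrings-const m (f ∘ (true ∷_))  c (λ bs eq → const (true ∷ bs) (cong suc eq)))
                    (sumℤ-bitStrings-const m (f ∘ (false ∷_)) c (λ bs eq → const (false ∷ bs) (cong suc eq))))
         (double c (+ (2 ^ m))))
  where
  double : ∀ c x → c * x + c * x ≡ c * (x + (x + 0ℤ))
  double = solve-∀

sumℤ-bitStrings-complement : ∀ m (f : List Bool → ℤ) →
  sumℤ (map f (bitStrings m)) ≡ sumℤ (map (f ∘ map not) (bitStrings m))
sumℤ-bitStrings-complement zero f = refl
sumℤ-bitStrings-complement (suc m) f = begin
    sumℤ (map f (bitStrings (suc m)))
  ≡⟨ sumℤ-bitStrings-suc m f ⟩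
    sumℤ (map (f ∘ (true ∷_)) (bitStrings m)) + sumℤ (map (f ∘ (false ∷_)) (bitStrings m))
  ≡⟨ cong₂ _+_ (sumℤ-bitStrings-complement m (f ∘ (true ∷_)))
               (sumℤ-bitStrings-complement m (f ∘ (false ∷_))) ⟩
    sumℤ (map (f ∘ (true ∷_) ∘ map not) (bitStrings m)) + sumℤ (map (f ∘ (false ∷_) ∘ map not) (bitStrings m))
  ≡⟨ +-comm (sumℤ (map (f ∘ (true ∷_) ∘ map not) (bitStrings m))) _ ⟩
    sumℤ (map (f ∘ (false ∷_) ∘ map not) (bitStrings m)) + sumℤ (map (f ∘ (true ∷_) ∘ map not) (bitStrings m))
  ≡⟨ sym (sumℤ-bitStrings-suc m (f ∘ map not)) ⟩
    sumℤ (map (f ∘ map not) (bitStrings (suc m))) ∎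
  where open ≡-Reasoning

theorem3p5 : (n : ℕ) →
    (sumℤ (map (λ bs → bA n (edgesOf n bs) + bI n (edgesOf n bs)) (bitStrings (length (pairs n))))
      ≡ + (n / 2) * + (2 ^ length (pairs n)))
    × (sumℤ (map (λ bs → bA n (edgesOf n bs) + bI n (edgesOf n (complementBits bs))) (bitStrings (length (pairs n))))
      ≡ + (n / 2) * + (2 ^ length (pairs n)))
theorem3p5 n = same-graph , complement-graph
  where
  open ≡-Reasoning
  m : ℕ
  m = length (pairs n)
  bAₙ bIₙ : List Bool → ℤ
  bAₙ bs = bA n (edgesOf n bs)
  bIₙ bs = bI n (edgesOf n bs)
  complement-graph : sumℤ (map (λ bs → bAₙ bs + bIₙ (complementBits bs)) (bitStrings m)) ≡ + (n / 2) * + (2 ^ m)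
  complement-graph = sumℤ-bitStrings-const m _ (+ (n / 2)) (bA+bI-complement n)
  same-graph : sumℤ (map (λ bs → bAₙ bs + bIₙ bs) (bitStrings m)) ≡ + (n / 2) * + (2 ^ m)
  same-graph = begin
      sumℤ (map (λ bs → bAₙ bs + bIₙ bs) (bitStrings m))
    ≡⟨ sumℤ-map-+ bAₙ bIₙ (bitStrings m) ⟩
      sumℤ (map bAₙ (bitStrings m)) + sumℤ (map bIₙ (bitStrings m))
    ≡⟨ cong (_+_ (sumℤ (map bAₙ (bitStrings m)))) (sumℤ-bitStrings-complement m bIₙ) ⟩
      sumℤ (map bAₙ (bitStrings m)) + sumℤ (map (bIₙ ∘ complementBits) (bitStrings m))
    ≡⟨ sym (sumℤ-map-+ bAₙ (bIₙ ∘ complementBits) (bitStrings m)) ⟩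
      sumℤ (map (λ bs → bAₙ bs + bIₙ (complementBits bs)) (bitStrings m))
    ≡⟨ complement-graph ⟩
      + (n / 2) * + (2 ^ m) ∎
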